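{- For every agent $i$: (a) for every formula $\phi$ of $\mathbf{LUT}$, $\vDash U_i\phi\to\bullet_i\phi$; (b) the converse schema is not valid, i.e. there is a formula $\phi$ with $\nvDash\bullet_i\phi\to U_i\phi$.
   Context: Let $\mathbf{P}$ be a countably infinite set of propositional variables and $\mathbf{I}$ a finite set of agents. The language $\mathbf{LUT}$ is given by $\phi::= p\mid\neg\phi\mid(\phi\land\phi)\mid K_i\phi\mid[\phi]\phi\mid U_i\phi$ ($p\in\mathbf{P}$, $i\in\mathbf{I}$); $\mathbf{EL}$ is the fragment without $[\cdot]$ and $U_i$. The abbreviation $\bullet_i\phi$ ("$\phi$ is an unknown truth for $i$") stands for $\phi\land\neg K_i\phi$. A model is $\mathcal{M}=\langle S,\{R_i\}_{i\in\mathbf{I}},V\rangle$ with $S\neq\emptyset$, each $R_i$ a reflexive relation on $S$, $V:\mathbf{P}\to2^S$. Truth: $p$ true at $s$ iff $s\in V(p)$; Boolean clauses as usual; $\mathcal{M},s\vDash K_i\phi$ iff $\phi$ holds at all $t$ with $sR_it$; $\mathcal{M},s\vDash[\psi]\phi$ iff ($\mathcal{M},s\vDash\psi$ implies $\mathcal{M}|_\psi,s\vDash\phi$), with $\mathcal{M}|_\psi$ the restriction of $\mathcal{M}$ to the states where $\psi$ is true; $\mathcal{M},s\vDash U_i\phi$ iff $\mathcal{M},s\vDash\phi$ and for all $\psi\in\mathbf{EL}$, $\mathcal{M},s\vDash[\psi]\neg K_i\phi$. $\vDash\phi$ means $\phi$ is true at every state of every model. -}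

module Defs where

open import Data.Nat using (ℕ)
open import Data.Fin using (Fin)
open import Data.Product using (Σ; _×_; _,_; proj₁)
open import Relation.Nullary using (¬_)

data Formula (n : ℕ) : Set where
  var  : ℕ → Formula n
  ~_   : Formula n → Formula n
  _∧_  : Formula n → Formula n → Formula n
  K    : Fin n → Formula n → Formula n
  [_]_ : Formula n → Formula n → Formula n
  U    : Fin n → Formula n → Formula n

data ELFormula (n : ℕ) : Set where
  var  : ℕ → ELFormula n
  ~_   : ELFormula n → ELFormula n
  _∧_  : ELFormula n → ELFormula n → ELFormula n
  K    : Fin n → ELFormula n → ELFormula n

_⇒_ : ∀ {n} → Formula n → Formula n → Formula n
φ ⇒ ψ = ~ (φ ∧ (~ ψ))

• : ∀ {n} → Fin n → Formula n → Formula n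
• i φ = φ ∧ (~ K i φ)

record Model (n : ℕ) : Set₁ where
  field
    S    : Set
    R    : Fin n → S → S → Set
    refl : ∀ i s → R i s s
    V    : ℕ → S → Set
open Model public

restrict : ∀ {n} (M : Model n) → (S M → Set) → Model n
restrict M P = record
  { S    = Σ (S M) P
  ; R    = λ i s t → R M i (proj₁ s) (proj₁ t)
  ; refl = λ i s → refl M i (proj₁ s)
  ; V    = λ p s → V M p (proj₁ s)
  }

satEL : ∀ {n} (M : Model n) → S M → ELFormula n → Set
satEL M s (var p)  = V M p s
satEL M s (~ φ)    = ¬ satEL M s φ
satEL M s (φ ∧ ψ)  = satEL M s φ × satEL M s ψ
satEL M s (K i φ)  = ∀ t → R M i s t → satEL M t φ

-- M,s ⊨ [ψ]φ  iff  M,s ⊨ ψ implies M|ψ,s ⊨ φ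
-- M,s ⊨ U_i φ iff  M,s ⊨ φ and for every EL formula ψ, M,s ⊨ [ψ] ¬ K_i φ,
--   the latter clause written out: if M,s ⊨ ψ then M|ψ,s ⊭ K_i φ.
sat : ∀ {n} (M : Model n) → S M → Formula n → Set
sat M s (var p)   = V M p s
sat M s (~ φ)     = ¬ sat M s φ
sat M s (φ ∧ ψ)   = sat M s φ × sat M s ψ
sat M s (K i φ)   = ∀ t → R M i s t → sat M t φ
sat M s ([ ψ ] φ) = (h : sat M s ψ) → sat (restrict M (λ t → sat M t ψ)) (s , h) φ
sat M s (U i φ)   = sat M s φ ×
  ((ψ : ELFormula _) (h : satEL M s ψ) →
     ¬ (∀ t → R (restrict M (λ u → satEL M u ψ)) i (s , h) t
              → sat (restrict M (λ u → satEL M u ψ)) t φ))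

⊨_ : ∀ {n} → Formula n → Set₁
⊨_ {n} φ = (M : Model n) (s : S M) → sat M s φ

{-# OPTIONS --safe #-}
module Submission where

-- (a) Truth of LUT formulas is invariant under bisimulation, also inside
-- announcements and U, since restricting two bisimilar models to matching
-- sets of states keeps them bisimilar.  Announcing a tautology gives a model
-- bisimilar to the original one, so U_i φ (which, for that announcement,
-- says that K_i φ fails after it) forces ¬ K_i φ.
-- (b) In a two-state model where i cannot tell apart a p-state from a ¬p-state,
-- p is an unknown truth, but announcing p makes it known.

open import Defs
open import Data.Nat using (ℕ)
open import Data.Fin using (Fin)
open import Data.Product using (Σ; _×_; _,_; proj₁; proj₂)
open import Data.Bool using (Bool; true; false)
open import Data.Unit using (⊤; tt)
open import Relation.Nullary using (¬_)
open import Relation.Binary.PropositionalEquality using (_≡_) renaming (refl to ≡-refl)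

record Bisimulation {n : ℕ} (M N : Model n) : Set₁ where
  field
    Z          : S M → S N → Set
    atom-forth : ∀ p s t → Z s t → V M p s → V N p t
    atom-back  : ∀ p s t → Z s t → V N p t → V M p s
    forth      : ∀ i s t s′ → Z s t → R M i s s′ → Σ (S N) λ t′ → R N i t t′ × Z s′ t′
    back       : ∀ i s t t′ → Z s t → R N i t t′ → Σ (S M) λ s′ → R M i s s′ × Z s′ t′
open Bisimulation

Bisimulation-sym : ∀ {n} {M N : Model n} → Bisimulation M N → Bisimulation N M
Bisimulation-sym B = record
  { Z          = λ t s → Z B s t
  ; atom-forth = λ p t s z → atom-back B p s t z
  ; atom-back  = λ p t s z → atom-forth B p s t z
  ; forth      = λ i t s t′ z r → back B i s t t′ z r
  ; back       = λ i t s s′ z r → forth B i s t s′ z r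
  }

restrict-Bisimulation : ∀ {n} {M N : Model n} (B : Bisimulation M N)
  (P : S M → Set) (Q : S N → Set) →
  (∀ s t → Z B s t → P s → Q t) → (∀ s t → Z B s t → Q t → P s) →
  Bisimulation (restrict M P) (restrict N Q)
restrict-Bisimulation B P Q P⇒Q Q⇒P = record
  { Z          = λ s t → Z B (proj₁ s) (proj₁ t)
  ; atom-forth = λ p s t → atom-forth B p (proj₁ s) (proj₁ t)
  ; atom-back  = λ p s t → atom-back B p (proj₁ s) (proj₁ t)
  ; forth      = λ i s t s′ z r →
      let (t′ , r′ , z′) = forth B i (proj₁ s) (proj₁ t) (proj₁ s′) z r
      in (t′ , P⇒Q _ _ z′ (proj₂ s′)) , r′ , z′
  ; back       = λ i s t t′ z r →
      let (s′ , r′ , z′) = back B i (proj₁ s) (proj₁ t) (proj₁ t′) z r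
      in (s′ , Q⇒P _ _ z′ (proj₂ t′)) , r′ , z′
  }

_|EL_ : ∀ {n} → Model n → ELFormula n → Model n
M |EL ψ = restrict M (λ u → satEL M u ψ)

satEL-Bisimulation : ∀ {n} (φ : ELFormula n) {M N : Model n} (B : Bisimulation M N) →
  ∀ s t → Z B s t → satEL M s φ → satEL N t φ
satEL-Bisimulation (var p) B s t z = atom-forth B p s t z
satEL-Bisimulation (~ φ) B s t z ¬φ φ′ =
  ¬φ (satEL-Bisimulation φ (Bisimulation-sym B) t s z φ′)
satEL-Bisimulation (φ ∧ ψ) B s t z (φ′ , ψ′) =
  satEL-Bisimulation φ B s t z φ′ , satEL-Bisimulation ψ B s t z ψ′
satEL-Bisimulation (K i φ) B s t z Kφ t′ r =
  let (s′ , r′ , z′) = back B i s t t′ z r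
  in satEL-Bisimulation φ B s′ t′ z′ (Kφ s′ r′)

sat-Bisimulation : ∀ {n} (φ : Formula n) {M N : Model n} (B : Bisimulation M N) →
  ∀ s t → Z B s t → sat M s φ → sat N t φ
sat-Bisimulation (var p) B s t z = atom-forth B p s t z
sat-Bisimulation (~ φ) B s t z ¬φ φ′ =
  ¬φ (sat-Bisimulation φ (Bisimulation-sym B) t s z φ′)
sat-Bisimulation (φ ∧ ψ) B s t z (φ′ , ψ′) =
  sat-Bisimulation φ B s t z φ′ , sat-Bisimulation ψ B s t z ψ′
sat-Bisimulation (K i φ) B s t z Kφ t′ r =
  let (s′ , r′ , z′) = back B i s t t′ z r
  in sat-Bisimulation φ B s′ t′ z′ (Kφ s′ r′)
sat-Bisimulation ([ ψ ] φ) B s t z [ψ]φ ψₜ =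
  sat-Bisimulation φ B|ψ (s , ψₛ) (t , ψₜ) z ([ψ]φ ψₛ)
  where
  ψₛ = sat-Bisimulation ψ (Bisimulation-sym B) t s z ψₜ
  B|ψ = restrict-Bisimulation B _ _
          (sat-Bisimulation ψ B)
          (λ s t z → sat-Bisimulation ψ (Bisimulation-sym B) t s z)
sat-Bisimulation (U i φ) {M} {N} B s t z (φₛ , unknownₛ) =
  sat-Bisimulation φ B s t z φₛ , unknownₜ
  where
  unknownₜ : (ψ : ELFormula _) (ψₜ : satEL N t ψ) →
    ¬ (∀ t′ → R (N |EL ψ) i (t , ψₜ) t′ → sat (N |EL ψ) t′ φ)
  unknownₜ ψ ψₜ Kφₜ = unknownₛ ψ ψₛ Kφₛ
    where
    ψₛ = satEL-Bisimulation ψ (Bisimulation-sym B) t s z ψₜ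
    B|ψ⁻¹ = restrict-Bisimulation (Bisimulation-sym B) _ _
              (λ t s z → satEL-Bisimulation ψ (Bisimulation-sym B) t s z)
              (λ t s → satEL-Bisimulation ψ B s t)
    Kφₛ : ∀ s′ → R (M |EL ψ) i (s , ψₛ) s′ → sat (M |EL ψ) s′ φ
    Kφₛ s′ r =
      let (t′ , r′ , z′) = forth B i s t (proj₁ s′) z r
      in sat-Bisimulation φ B|ψ⁻¹ (t′ , satEL-Bisimulation ψ B _ _ z′ (proj₂ s′)) s′ z′
           (Kφₜ _ r′)

restrict-everywhere-Bisimulation : ∀ {n} (M : Model n) (P : S M → Set) →
  (∀ s → P s) → Bisimulation M (restrict M P)
restrict-everywhere-Bisimulation M P everywhere = record
  { Z          = λ s t → s ≡ proj₁ t
  ; atom-forth = λ { p s t ≡-refl → λ v → v }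
  ; atom-back  = λ { p s t ≡-refl → λ v → v }
  ; forth      = λ { i s t s′ ≡-refl r → (s′ , everywhere s′) , r , ≡-refl }
  ; back       = λ { i s t t′ ≡-refl r → proj₁ t′ , r , ≡-refl }
  }

⊤EL : ∀ {n} → ELFormula n
⊤EL = ~ (var 0 ∧ (~ var 0))

⊤EL-valid : ∀ {n} (M : Model n) s → satEL M s ⊤EL
⊤EL-valid M s (p , ¬p) = ¬p p

U⇒• : ∀ {n} (i : Fin n) (φ : Formula n) → ⊨ (U i φ ⇒ • i φ)
U⇒• i φ M s ((φₛ , unknown) , ¬•φ) = ¬•φ (φₛ , ¬Kφ)
  where
  B = restrict-everywhere-Bisimulation M _ (⊤EL-valid M)
  ¬Kφ : ¬ sat M s (K i φ)
  ¬Kφ Kφ = unknown ⊤EL (⊤EL-valid M s)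
    λ t r → sat-Bisimulation φ B (proj₁ t) t ≡-refl (Kφ (proj₁ t) r)

indistinguishable-p-¬p : ∀ {n} → Model n
indistinguishable-p-¬p = record
  { S    = Bool
  ; R    = λ _ _ _ → ⊤
  ; refl = λ _ _ → tt
  ; V    = λ _ b → b ≡ true
  }

•⇏U : ∀ {n} (i : Fin n) → ¬ (⊨ (• i (var 0) ⇒ U i (var 0)))
•⇏U i valid = valid indistinguishable-p-¬p true (•p , ¬Up)
  where
  •p : sat indistinguishable-p-¬p true (• i (var 0))
  •p = ≡-refl , λ Kp → false≢true (Kp false tt)
    where
    false≢true : ¬ false ≡ true
    false≢true ()
  ¬Up : ¬ sat indistinguishable-p-¬p true (U i (var 0))
  ¬Up (_ , unknown) = unknown (var 0) ≡-refl λ t _ → proj₂ t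

mainTheorem10 : (n : ℕ) (i : Fin n) →
    ((φ : Formula n) → ⊨ (U i φ ⇒ • i φ))
    × Σ (Formula n) (λ φ → ¬ (⊨ (• i φ ⇒ U i φ)))
mainTheorem10 n i = U⇒• i , var 0 , •⇏U i
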